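{- For any $\mathsf{R}\subseteq[n]$ and $r\in\mathcal{Y}_n$, $\gamma(r)|_\mathsf{R}=\gamma(r|_\mathsf{R})$.
   Context: Permutations in one-line notation; $\mathrm{st}(a_1,\dots,a_p)$ is the permutation of $[p]$ with the same relative order as the distinct integers $a_i$. For $\sigma\in\mathfrak{S}_p,\tau\in\mathfrak{S}_q$, $\sigma\vee\tau$ has values $\sigma(1)+q,\dots,\sigma(p)+q,p+q+1,\tau(1),\dots,\tau(q)$. $\mathcal{Y}_n$: rooted planar binary trees with $n$ internal nodes, $\mathcal{Y}_0=\{|\}$, each $t$ uniquely $t_l\vee t_r$. $\lambda(\mathrm{id}_0)=|$, $\lambda(\sigma)=\lambda(\mathrm{st}(\sigma(1..j-1)))\vee\lambda(\mathrm{st}(\sigma(j+1..n)))$ with $j=\sigma^{ -1}(n)$; $\gamma(|)=\mathrm{id}_0$, $\gamma(t)=\gamma(t_l)\vee\gamma(t_r)$. For $\mathsf{R}=\{R_1<\dots<R_p\}\subseteq[n]$, $\rho\in\mathfrak{S}_n$ and $r\in\mathcal{Y}_n$: $\rho|_\mathsf{R}=\mathrm{st}(\rho(R_1),\dots,\rho(R_p))$ and $r|_\mathsf{R}=\lambda(\gamma(r)|_\mathsf{R})$. -}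

module Defs where

open import Data.Nat using (ℕ; zero; suc; _+_; _<ᵇ_; _≡ᵇ_)
open import Data.Bool using (Bool; true; false; if_then_else_)
open import Data.List using (List; []; _∷_; _++_; map; length; [_])
open import Data.Product using (_×_; _,_)
open import Data.Vec using (Vec; []; _∷_)
open import Data.Fin.Subset using (Subset)

-- Permutations in one-line notation: σ ∈ 𝔖_n is the list σ(1), …, σ(n)
-- of values in {1, …, n}.
Perm : Set
Perm = List ℕ

countLess : ℕ → List ℕ → ℕ
countLess x []       = 0
countLess x (y ∷ ys) = if y <ᵇ x then suc (countLess x ys) else countLess x ys

-- standardization st(a_1,…,a_p): for distinct a_i, the permutation of [p]
-- with the same relative order (a_i ↦ 1 + #{k | a_k < a_i}).
st : List ℕ → Perm
st xs = map (λ x → suc (countLess x xs)) xs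

_∨ₚ_ : Perm → Perm → Perm
σ ∨ₚ τ = map (λ x → x + length τ) σ ++ [ suc (length σ + length τ) ] ++ τ

-- rooted planar binary trees; 𝒴_n = trees with n internal nodes
data Tree : Set where
  leaf : Tree
  _∨ₜ_ : Tree → Tree → Tree

nodes : Tree → ℕ
nodes leaf       = 0
nodes (l ∨ₜ r) = suc (nodes l + nodes r)

γ : Tree → Perm
γ leaf       = []
γ (l ∨ₜ r) = γ l ∨ₚ γ r

splitAtValue : ℕ → List ℕ → List ℕ × List ℕ
splitAtValue v []       = [] , []
splitAtValue v (x ∷ xs) with x ≡ᵇ v
... | true  = [] , xs
... | false with splitAtValue v xs
...   | (a , b) = x ∷ a , b

-- λ with a fuel argument (fuel = length suffices, as the pieces shrink)
λ-fuel : ℕ → Perm → Tree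
λ-fuel _        []       = leaf
λ-fuel zero     (_ ∷ _)  = leaf
λ-fuel (suc f)  σ@(_ ∷ _) with splitAtValue (length σ) σ
... | (a , b) = λ-fuel f (st a) ∨ₜ λ-fuel f (st b)

λₚ : Perm → Tree
λₚ σ = λ-fuel (length σ) σ

select : ∀ {n} → List ℕ → Subset n → List ℕ
select []       _             = []
select (_ ∷ _)  []            = []
select (x ∷ xs) (true  ∷ R)   = x ∷ select xs R
select (x ∷ xs) (false ∷ R)   = select xs R

restrictPerm : ∀ {n} → Perm → Subset n → Perm
restrictPerm ρ R = st (select ρ R)

restrictTree : ∀ {n} → Tree → Subset n → Tree
restrictTree r R = λₚ (restrictPerm (γ r) R)

{-# OPTIONS --safe #-}
-- Call a sequence tree-shaped if it is empty or of the form A ++ m ∷ B with A, B tree-shaped,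
-- m above all entries and every entry of A above every entry of B (for distinct entries: the
-- 132-avoiding sequences).  Every γ t is tree-shaped, and unlike the image of γ this class is
-- closed under taking subsequences.  Standardising a tree-shaped sequence gives some γ t, since
-- st turns A ++ m ∷ B into st A ∨ₚ st B.  As λ is a left inverse of γ, γ (λ (st ys)) = st ys
-- for every subsequence ys of γ r.
module Submission where

open import Defs
open import Data.Nat using (ℕ; zero; suc; _+_; _<ᵇ_; _≡ᵇ_; _≤_; _<_; z≤n; s≤s; s≤s⁻¹)
open import Data.Nat.Properties
open import Data.Bool using (true; false)
open import Data.Vec using ([]; _∷_)
open import Data.Fin.Subset using (Subset)
open import Data.List.Relation.Binary.Sublist.Propositional using (_⊆_; []; _∷_; _∷ʳ_; minimum)
open import Data.List.Relation.Binary.Sublist.Propositional.Properties using (All-resp-⊆)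
open import Data.List using (List; []; _∷_; _++_; map; length)
open import Data.List.Properties using (++-assoc; map-++; length-map; length-++; map-∘; map-cong; map-cong-local)
open import Data.List.Relation.Unary.All as All using (All; []; _∷_)
open import Data.List.Relation.Unary.All.Properties using (map⁺; ++⁺; ++⁻)
open import Data.Product using (_×_; _,_; ∃; ∃₂; proj₂)
open import Relation.Nullary using (¬_; yes; no; contradiction)
open import Function using (_∘_)
open import Relation.Nullary.Reflects using (ofʸ; ofⁿ)
open import Relation.Binary.PropositionalEquality
open ≡-Reasoning

private
  variable
    x y m : ℕ
    xs ys A B σ τ : List ℕ

countLess-∷-< : ∀ ys → y < x → countLess x (y ∷ ys) ≡ suc (countLess x ys)
countLess-∷-< {y} {x} _ y<x with y <ᵇ x | <ᵇ-reflects-< y x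
... | true  | _        = refl
... | false | ofⁿ y≮x = contradiction y<x y≮x

countLess-∷-≮ : ∀ ys → ¬ y < x → countLess x (y ∷ ys) ≡ countLess x ys
countLess-∷-≮ {y} {x} _ y≮x with y <ᵇ x | <ᵇ-reflects-< y x
... | false | _        = refl
... | true  | ofʸ y<x = contradiction y<x y≮x

countLess-++ : ∀ x A B → countLess x (A ++ B) ≡ countLess x A + countLess x B
countLess-++ x []      B = refl
countLess-++ x (y ∷ A) B with y <ᵇ x
... | true  = cong suc (countLess-++ x A B)
... | false = countLess-++ x A B

countLess-++-∷ : ∀ A B → ¬ m < x → countLess x (A ++ m ∷ B) ≡ countLess x A + countLess x B
countLess-++-∷ {m} {x} A B m≮x =
  trans (countLess-++ x A (m ∷ B)) (cong (countLess x A +_) (countLess-∷-≮ B m≮x))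

countLess-all< : All (_< x) xs → countLess x xs ≡ length xs
countLess-all< []                        = refl
countLess-all< {xs = _ ∷ ys} (y<x ∷ ys<x) = trans (countLess-∷-< ys y<x) (cong suc (countLess-all< ys<x))

countLess-all> : All (x <_) xs → countLess x xs ≡ 0
countLess-all> []                        = refl
countLess-all> {xs = _ ∷ ys} (x<y ∷ x<ys) = trans (countLess-∷-≮ ys (<⇒≯ x<y)) (countLess-all> x<ys)

countLess-+ : ∀ x c ys → countLess (x + c) (map (_+ c) ys) ≡ countLess x ys
countLess-+ x c []       = refl
countLess-+ x c (y ∷ ys) with y <? x
... | yes y<x = trans (countLess-∷-< (map (_+ c) ys) (+-monoˡ-< c y<x))
                      (trans (cong suc (countLess-+ x c ys)) (sym (countLess-∷-< ys y<x)))
... | no  y≮x = trans (countLess-∷-≮ (map (_+ c) ys) (y≮x ∘ +-cancelʳ-< c y x))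
                      (trans (countLess-+ x c ys) (sym (countLess-∷-≮ ys y≮x)))

rank : List ℕ → ℕ → ℕ
rank xs x = suc (countLess x xs)

length-st : ∀ xs → length (st xs) ≡ length xs
length-st xs = length-map (rank xs) xs

st-+ : ∀ c ys → st (map (_+ c) ys) ≡ st ys
st-+ c ys = begin
  map (rank (map (_+ c) ys)) (map (_+ c) ys)  ≡⟨ map-∘ ys ⟨
  map (rank (map (_+ c) ys) ∘ (_+ c)) ys      ≡⟨ map-cong (λ y → cong suc (countLess-+ y c ys)) ys ⟩
  st ys                                       ∎

_≻_ : List ℕ → List ℕ → Set
A ≻ B = All (λ a → All (_< a) B) A

≻-transpose : A ≻ B → All (λ b → All (b <_) A) B
≻-transpose A≻B = All.tabulate (λ b∈B → All.map (λ B<a → All.lookup B<a b∈B) A≻B)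

record Separated (A : List ℕ) (m : ℕ) (B : List ℕ) : Set where
  field
    left<m     : All (_< m) A
    right<m    : All (_< m) B
    left≻right : A ≻ B

st-∨ : Separated A m B → st (A ++ m ∷ B) ≡ st A ∨ₚ st B
st-∨ {A} {m} {B} sep = begin
  map r (A ++ m ∷ B)        ≡⟨ map-++ r A (m ∷ B) ⟩
  map r A ++ r m ∷ map r B  ≡⟨ cong₂ _++_ left (cong₂ _∷_ middle right) ⟩
  st A ∨ₚ st B              ∎
  where
  open Separated sep
  r : ℕ → ℕ
  r = rank (A ++ m ∷ B)

  left : map r A ≡ map (_+ length (st B)) (st A)
  left = trans (map-cong-local (All.zipWith rank-left (left<m , left≻right))) (map-∘ A)
    where
    rank-left : ∀ {x} → x < m × All (_< x) B → r x ≡ rank A x + length (st B)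
    rank-left {x} (x<m , B<x) = cong suc (begin
      countLess x (A ++ m ∷ B)         ≡⟨ countLess-++-∷ A B (<⇒≯ x<m) ⟩
      countLess x A + countLess x B    ≡⟨ cong (countLess x A +_) (countLess-all< B<x) ⟩
      countLess x A + length B         ≡⟨ cong (countLess x A +_) (length-st B) ⟨
      countLess x A + length (st B)    ∎)

  middle : r m ≡ suc (length (st A) + length (st B))
  middle = cong suc (begin
    countLess m (A ++ m ∷ B)       ≡⟨ countLess-++-∷ A B (n≮n m) ⟩
    countLess m A + countLess m B  ≡⟨ cong₂ _+_ (countLess-all< left<m) (countLess-all< right<m) ⟩
    length A + length B            ≡⟨ cong₂ _+_ (length-st A) (length-st B) ⟨
    length (st A) + length (st B)  ∎)

  right : map r B ≡ st B
  right = map-cong-local (All.zipWith rank-right (right<m , ≻-transpose left≻right))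
    where
    rank-right : ∀ {x} → x < m × All (x <_) A → r x ≡ rank B x
    rank-right {x} (x<m , x<A) =
      cong suc (trans (countLess-++-∷ A B (<⇒≯ x<m)) (cong (_+ countLess x B) (countLess-all> x<A)))

splitAtValue-++ : ∀ A B → All (_< m) A → splitAtValue m (A ++ m ∷ B) ≡ (A , B)
splitAtValue-++ {m} [] B [] with m ≡ᵇ m | ≡⇒≡ᵇ m m refl
... | true | _ = refl
splitAtValue-++ {m} (x ∷ A) B (x<m ∷ A<m) with x ≡ᵇ m | ≡ᵇ⇒≡ x m
... | true  | x≡m = contradiction (x≡m _) (<⇒≢ x<m)
... | false | _   rewrite splitAtValue-++ A B A<m = refl

λ-fuel-split : ∀ f A m B {a b} → splitAtValue (length (A ++ m ∷ B)) (A ++ m ∷ B) ≡ (a , b) →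
               λ-fuel (suc f) (A ++ m ∷ B) ≡ λ-fuel f (st a) ∨ₜ λ-fuel f (st b)
λ-fuel-split f []      m B refl = refl
λ-fuel-split f (x ∷ A) m B refl = refl

length-∨ₚ : ∀ σ τ → length (σ ∨ₚ τ) ≡ suc (length σ + length τ)
length-∨ₚ σ τ = begin
  length (map (_+ length τ) σ ++ _ ∷ τ)         ≡⟨ length-++ (map (_+ length τ) σ) ⟩
  length (map (_+ length τ) σ) + suc (length τ) ≡⟨ cong (_+ suc (length τ)) (length-map (_+ length τ) σ) ⟩
  length σ + suc (length τ)                     ≡⟨ +-suc (length σ) (length τ) ⟩
  suc (length σ + length τ)                     ∎

shifted<top : ∀ (σ τ : List ℕ) → All (_≤ length σ) σ →
              All (_< suc (length σ + length τ)) (map (_+ length τ) σ)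
shifted<top σ τ σ≤ = map⁺ {f = _+ length τ} (All.map (λ x≤ → s≤s (+-monoˡ-≤ (length τ) x≤)) σ≤)

λ-fuel-∨ₚ : ∀ f σ τ → All (_≤ length σ) σ →
            λ-fuel (suc f) (σ ∨ₚ τ) ≡ λ-fuel f (st σ) ∨ₜ λ-fuel f (st τ)
λ-fuel-∨ₚ f σ τ σ≤ = trans (λ-fuel-split f σ' (suc (length σ + length τ)) τ split)
                             (cong (λ ρ → λ-fuel f ρ ∨ₜ λ-fuel f (st τ)) (st-+ (length τ) σ))
  where
  σ' : List ℕ
  σ' = map (_+ length τ) σ
  split : splitAtValue (length (σ ∨ₚ τ)) (σ ∨ₚ τ) ≡ (σ' , τ)
  split = trans (cong (λ v → splitAtValue v (σ ∨ₚ τ)) (length-∨ₚ σ τ))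
                (splitAtValue-++ σ' τ (shifted<top σ τ σ≤))

Bounded : ℕ → List ℕ → Set
Bounded n xs = All (λ x → 1 ≤ x × x ≤ n) xs

∨ₚ-separated : Bounded (length σ) σ → Bounded (length τ) τ →
               Separated (map (_+ length τ) σ) (suc (length σ + length τ)) τ
∨ₚ-separated {σ} {τ} σ-bounded τ-bounded = record
  { left<m     = shifted<top σ τ (All.map proj₂ σ-bounded)
  ; right<m    = All.map (λ (_ , y≤q) → s≤s (≤-trans y≤q (m≤n+m q p))) τ-bounded
  ; left≻right = map⁺ {f = _+ q}
      (All.map (λ (1≤x , _) → All.map (λ (_ , y≤q) → ≤-<-trans y≤q (m<n+m q 1≤x)) τ-bounded) σ-bounded)
  }
  where
  p q : ℕ
  p = length σ
  q = length τ

∨ₚ-bounded : Bounded (length σ) σ → Bounded (length τ) τ → Bounded (length (σ ∨ₚ τ)) (σ ∨ₚ τ)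
∨ₚ-bounded {σ} {τ} σ-bounded τ-bounded =
  subst (λ n → Bounded n (σ ∨ₚ τ)) (sym (length-∨ₚ σ τ)) (++⁺ σ′-bounded ((s≤s z≤n , ≤-refl) ∷ τ′-bounded))
  where
  p q : ℕ
  p = length σ
  q = length τ
  σ′-bounded : Bounded (suc (p + q)) (map (_+ q) σ)
  σ′-bounded = map⁺ {f = _+ q}
    (All.map (λ (1≤x , x≤p) → ≤-trans 1≤x (m≤m+n _ q) , m≤n⇒m≤1+n (+-monoˡ-≤ q x≤p)) σ-bounded)
  τ′-bounded : Bounded (suc (p + q)) τ
  τ′-bounded = All.map (λ (1≤y , y≤q) → 1≤y , m≤n⇒m≤1+n (≤-trans y≤q (m≤n+m q p))) τ-bounded

γ-bounded : ∀ t → Bounded (length (γ t)) (γ t)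
γ-bounded leaf     = []
γ-bounded (l ∨ₜ r) = ∨ₚ-bounded (γ-bounded l) (γ-bounded r)

γ-separated : ∀ l r →
              Separated (map (_+ length (γ r)) (γ l)) (suc (length (γ l) + length (γ r))) (γ r)
γ-separated l r = ∨ₚ-separated (γ-bounded l) (γ-bounded r)

st-γ : ∀ t → st (γ t) ≡ γ t
st-γ leaf     = refl
st-γ (l ∨ₜ r) = begin
  st (γ l ∨ₚ γ r)                               ≡⟨ st-∨ (γ-separated l r) ⟩
  st (map (_+ length (γ r)) (γ l)) ∨ₚ st (γ r)  ≡⟨ cong₂ _∨ₚ_ (trans (st-+ _ (γ l)) (st-γ l)) (st-γ r) ⟩
  γ l ∨ₚ γ r                                    ∎

λ-fuel-γ : ∀ f t → length (γ t) ≤ f → λ-fuel f (γ t) ≡ t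
λ-fuel-γ f       leaf     _     = refl
λ-fuel-γ zero    (l ∨ₜ r) len≤f with () ← subst (_≤ 0) (length-∨ₚ (γ l) (γ r)) len≤f
λ-fuel-γ (suc f) (l ∨ₜ r) len≤f = begin
  λ-fuel (suc f) (γ l ∨ₚ γ r)
    ≡⟨ λ-fuel-∨ₚ f (γ l) (γ r) (All.map proj₂ (γ-bounded l)) ⟩
  λ-fuel f (st (γ l)) ∨ₜ λ-fuel f (st (γ r))
    ≡⟨ cong₂ (λ σ τ → λ-fuel f σ ∨ₜ λ-fuel f τ) (st-γ l) (st-γ r) ⟩
  λ-fuel f (γ l) ∨ₜ λ-fuel f (γ r)
    ≡⟨ cong₂ _∨ₜ_ (λ-fuel-γ f l (m+n≤o⇒m≤o _ len≤)) (λ-fuel-γ f r (m+n≤o⇒n≤o _ len≤)) ⟩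
  l ∨ₜ r
    ∎
  where
  len≤ : length (γ l) + length (γ r) ≤ f
  len≤ = s≤s⁻¹ (subst (_≤ suc f) (length-∨ₚ (γ l) (γ r)) len≤f)

λₚ-γ : ∀ t → λₚ (γ t) ≡ t
λₚ-γ t = λ-fuel-γ (length (γ t)) t ≤-refl

data TreeShaped : List ℕ → Set where
  []   : TreeShaped []
  node : TreeShaped A → TreeShaped B → Separated A m B → TreeShaped (A ++ m ∷ B)

st-treeShaped : TreeShaped xs → ∃ λ t → st xs ≡ γ t
st-treeShaped []                = leaf , refl
st-treeShaped (node sA sB sep) with st-treeShaped sA | st-treeShaped sB
... | tA , stA≡γtA | tB , stB≡γtB = tA ∨ₜ tB , trans (st-∨ sep) (cong₂ _∨ₚ_ stA≡γtA stB≡γtB)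

separated-+ : ∀ c → Separated A m B → Separated (map (_+ c) A) (m + c) (map (_+ c) B)
separated-+ c sep = record
  { left<m     = map⁺ (All.map (+-monoˡ-< c) left<m)
  ; right<m    = map⁺ (All.map (+-monoˡ-< c) right<m)
  ; left≻right = map⁺ (All.map (λ B<a → map⁺ (All.map (+-monoˡ-< c) B<a)) left≻right)
  }
  where open Separated sep

treeShaped-+ : ∀ c → TreeShaped xs → TreeShaped (map (_+ c) xs)
treeShaped-+ c []                                       = []
treeShaped-+ c (node {A = A} {B = B} {m = m} sA sB sep) =
  subst TreeShaped (sym (map-++ (_+ c) A (m ∷ B)))
    (node (treeShaped-+ c sA) (treeShaped-+ c sB) (separated-+ c sep))

γ-treeShaped : ∀ t → TreeShaped (γ t)
γ-treeShaped leaf     = []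
γ-treeShaped (l ∨ₜ r) = node (treeShaped-+ _ (γ-treeShaped l)) (γ-treeShaped r) (γ-separated l r)

⊆-++-split : ∀ {X : Set} (as : List X) {bs ys} → ys ⊆ as ++ bs →
             ∃₂ λ ys₁ ys₂ → ys ≡ ys₁ ++ ys₂ × ys₁ ⊆ as × ys₂ ⊆ bs
⊆-++-split []       τ         = [] , _ , refl , [] , τ
⊆-++-split (a ∷ as) (.a ∷ʳ τ) with ⊆-++-split as τ
... | ys₁ , ys₂ , refl , τ₁ , τ₂ = ys₁ , ys₂ , refl , a ∷ʳ τ₁ , τ₂
⊆-++-split (a ∷ as) (refl ∷ τ) with ⊆-++-split as τ
... | ys₁ , ys₂ , refl , τ₁ , τ₂ = a ∷ ys₁ , ys₂ , refl , refl ∷ τ₁ , τ₂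

≻-⊆ : ∀ {A′ B′} → A′ ⊆ A → B′ ⊆ B → A ≻ B → A′ ≻ B′
≻-⊆ τA τB A≻B = All-resp-⊆ τA (All.map (All-resp-⊆ τB) A≻B)

separated-⊆ : ∀ {A′ B′} → A′ ⊆ A → B′ ⊆ B → Separated A m B → Separated A′ m B′
separated-⊆ τA τB sep = record
  { left<m     = All-resp-⊆ τA left<m
  ; right<m    = All-resp-⊆ τB right<m
  ; left≻right = ≻-⊆ τA τB left≻right
  }
  where open Separated sep

separated-++ : ∀ {C} → Separated A m B → All (_< m) C → A ≻ C → Separated A m (B ++ C)
separated-++ sep C<m A≻C = record
  { left<m     = left<m
  ; right<m    = ++⁺ right<m C<m
  ; left≻right = All.zipWith (λ (B<a , C<a) → ++⁺ B<a C<a) (left≻right , A≻C)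
  }
  where open Separated sep

treeShaped-++ : TreeShaped A → TreeShaped B → A ≻ B → TreeShaped (A ++ B)
treeShaped-++ []                                              sC _      = sC
treeShaped-++ {B = C} (node {A = A} {B = B} {m = m} sA sB sep) sC ABC≻C with ++⁻ A ABC≻C
... | A≻C , C<m ∷ B≻C = subst TreeShaped (sym (++-assoc A (m ∷ B) C))
  (node sA (treeShaped-++ sB sC B≻C) (separated-++ sep C<m A≻C))

treeShaped-⊆ : TreeShaped xs → ys ⊆ xs → TreeShaped ys
treeShaped-⊆ []                                        [] = []
treeShaped-⊆ (node {A = A} {B = B} {m = m} sA sB sep) τ with ⊆-++-split A τ
... | _ , _ , refl , τA , (.m ∷ʳ τB) =
  treeShaped-++ (treeShaped-⊆ sA τA) (treeShaped-⊆ sB τB) (≻-⊆ τA τB (Separated.left≻right sep))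
... | _ , _ , refl , τA , (refl ∷ τB) =
  node (treeShaped-⊆ sA τA) (treeShaped-⊆ sB τB) (separated-⊆ τA τB sep)

select-⊆ : ∀ {n} xs (R : Subset n) → select xs R ⊆ xs
select-⊆ []       R           = []
select-⊆ (x ∷ xs) []          = minimum _
select-⊆ (x ∷ xs) (true  ∷ R) = refl ∷ select-⊆ xs R
select-⊆ (x ∷ xs) (false ∷ R) = x ∷ʳ select-⊆ xs R

γ-λₚ : ∀ {σ} t → σ ≡ γ t → γ (λₚ σ) ≡ σ
γ-λₚ t refl = cong γ (λₚ-γ t)

lemma8p5 : (n : ℕ) (R : Subset n) (r : Tree) → nodes r ≡ n →
           restrictPerm (γ r) R ≡ γ (restrictTree r R)
-- select stops at the end of the shorter of γ r and R.
lemma8p5 n R r _ with st-treeShaped (treeShaped-⊆ (γ-treeShaped r) (select-⊆ (γ r) R))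
... | t , st≡γt = sym (γ-λₚ t st≡γt)
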